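{- Let $q\geq 4$ be an integer, let $\mathcal{A}$ be an affine plane of order $q$, let $\mathcal{L}$ be a set of $q+1$ pairwise non-parallel lines of $\mathcal{A}$ and let $\mathcal{K}$ be the Kakeya set determined by $\mathcal{L}$. If $$|\mathcal{K}|> q^2-\left((q+1)\sqrt{q+\tfrac14}-\frac{3q+1}{2}\right)$$ (this quantity equals $q^2-f_q(q-\kappa)$ where $f_q(k)=\frac{qk}{q+1-k}$ and $\kappa=\sqrt{q+\tfrac14}-\tfrac12$), then $\mathcal{K}$ contains a $(q+1-k)$-knot for some integer $k$ with $0\leq k<\sqrt{q+\tfrac14}-\tfrac12$, and $$|\mathcal{K}|\in\left[q^2-kq+\frac{k(k+1)}{2},\ q^2-kq+k^2\right].$$
   Context: An affine plane of order $q$ is a set of $q^2$ points and $q^2+q$ lines (each line a set of $q$ points) such that any two points lie on exactly one line and any two lines meet in at most one point; its lines are partitioned into $q+1$ parallel classes, each consisting of $q$ pairwise disjoint lines. A Kakeya set is the set $\mathcal{K}$ of points covered by a set $\mathcal{L}$ of $q+1$ lines containing exactly one line from each parallel class. For an integer $j$, a $j$-knot of $\mathcal{K}$ is a point lying on exactly $j$ lines of $\mathcal{L}$. -}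

module Defs where

open import Data.Nat using (ℕ; zero; suc; _+_; _*_)
open import Data.Bool using (Bool; true; false; if_then_else_; _∧_)
open import Data.Fin using (Fin; _≟_)
open import Data.List using (List; map; allFin)
open import Data.Nat.ListAction using (sum)
open import Data.Bool.ListAction using (any)
open import Data.Product using (Σ; _×_; _,_; ∃)
open import Data.Sum using (_⊎_)
open import Relation.Binary.PropositionalEquality using (_≡_; _≢_)
open import Relation.Nullary using (¬_)
open import Relation.Nullary.Decidable using (⌊_⌋)

count : (n : ℕ) → (Fin n → Bool) → ℕ
count n f = sum (map (λ i → if f i then 1 else 0) (allFin n))

record AffinePlane (q : ℕ) : Set where
  field
    inc : Fin (q * q) → Fin (q * q + q) → Bool
    lineSize : ∀ l → count (q * q) (λ p → inc p l) ≡ q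
    joinExists : ∀ p p' → p ≢ p' →
      Σ (Fin (q * q + q)) λ l → inc p l ≡ true × inc p' l ≡ true
    joinUnique : ∀ p p' → p ≢ p' → ∀ l l' →
      inc p l ≡ true → inc p' l ≡ true →
      inc p l' ≡ true → inc p' l' ≡ true → l ≡ l'
    meetAtMostOne : ∀ l l' → l ≢ l' → ∀ p p' →
      inc p l ≡ true → inc p l' ≡ true →
      inc p' l ≡ true → inc p' l' ≡ true → p ≡ p'
    parClass : Fin (q * q + q) → Fin (suc q)
    classSize : ∀ c → count (q * q + q) (λ l → ⌊ parClass l ≟ c ⌋) ≡ q
    classDisjoint : ∀ l l' → parClass l ≡ parClass l' → l ≢ l' →
      ∀ p → ¬ (inc p l ≡ true × inc p l' ≡ true)

module _ {q : ℕ} (A : AffinePlane q) where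
  open AffinePlane A

  Parallel : Fin (q * q + q) → Fin (q * q + q) → Set
  Parallel l l' = l ≡ l' ⊎ (∀ p → ¬ (inc p l ≡ true × inc p l' ≡ true))

  PairwiseNonParallel : (Fin (suc q) → Fin (q * q + q)) → Set
  PairwiseNonParallel ℓ = ∀ i j → i ≢ j → ¬ Parallel (ℓ i) (ℓ j)

  inKakeya : (Fin (suc q) → Fin (q * q + q)) → Fin (q * q) → Bool
  inKakeya ℓ p = any (λ i → inc p (ℓ i)) (allFin (suc q))

  kakeyaSize : (Fin (suc q) → Fin (q * q + q)) → ℕ
  kakeyaSize ℓ = count (q * q) (inKakeya ℓ)

  -- number of lines of ℓ through p (p is a j-knot iff this equals j)
  knotDegree : (Fin (suc q) → Fin (q * q + q)) → Fin (q * q) → ℕ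
  knotDegree ℓ p = count (suc q) (λ i → inc p (ℓ i))

{-# OPTIONS --safe #-}
-- Let P be a point on the maximal number m = q + 1 − k of lines of ℓ, and let t(p), o(p)
-- count the lines of ℓ through p that pass through, resp. miss, P. Since two distinct lines
-- of ℓ meet exactly once, the sums over all points of t, o, t·o and o² are determined by
-- m, k and q, and t(p) ≤ 1 for p ≠ P. Inclusion–exclusion at each point,
--   t + o − t·o − o(o−1)/2 ≤ [p ∈ K] ≤ t + o − t·o,
-- summed over all points gives q² − kq + k(k+1)/2 ≤ |K| ≤ q² − kq + k². Maximality of m
-- gives (d − 1)(d − m) ≤ 0 at every covered point of degree d, whence m|K| ≤ (m − 1)q(q + 1).
-- Finally let D = 2q² + 3q + 1 − 2|K| and b = q − k, and suppose (2k + 1)² ≥ 4q + 1. The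
-- upper bound gives D ≥ 2kb + 3q + 1, whose square exceeds (q + 1)²(4q + 1) by
-- 4(k² + k − q)(b² + b − q); the degree bound gives mD ≥ (q + 1)(m + 2q), where
-- (m + 2q)² − (4q + 1)m² = 4q(q − b² − b). One of the two differences is nonnegative, so
-- D² ≥ (q + 1)²(4q + 1), contradicting the hypothesis.
module Submission where

open import Defs
open import Data.Bool using (Bool; true; false; if_then_else_; _∧_; not)
open import Data.Bool.ListAction using (any)
open import Data.Bool.Properties using (∧-idem; ∧-conicalˡ; ∧-conicalʳ)
open import Data.Fin using (Fin; zero; suc; _≟_; fromℕ<)
import Data.Fin.Properties as Fin
open import Data.List using ([]; _∷_; map; tabulate; allFin)
open import Data.List.Extrema.Nat using (argmax; f[xs]≤f[argmax])
open import Data.List.Membership.Propositional.Properties using (∈-allFin)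
open import Data.List.Properties using (map-tabulate)
open import Data.List.Relation.Unary.All using (lookup)
open import Data.Nat hiding (_≟_)
open import Data.Nat.Properties hiding (_≟_)
open import Algebra.Properties.Semiring.Sum +-*-semiring
  using (sum; sum-syntax; ∑-distrib-+; ∑-comm; *-distribˡ-sum; *-distribʳ-sum; sum-cong-≗)
import Data.Nat.ListAction as List
open import Data.Nat.Tactic.RingSolver using (solve; solve-∀)
open import Data.Product using (Σ; _×_; _,_; proj₁; proj₂)
open import Data.Sum using (inj₁; inj₂)
open import Function using (_∘_; id; case_of_)
open import Relation.Binary.PropositionalEquality
open import Relation.Nullary using (¬_; yes; no; does; contradiction)
open import Relation.Nullary.Decidable using (dec-true; dec-false)

indicator : Bool → ℕ
indicator b = if b then 1 else 0

indicator-∧ : ∀ a b → indicator a * indicator b ≡ indicator (a ∧ b)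
indicator-∧ true b = +-identityʳ (indicator b)
indicator-∧ false b = refl

sum-tabulate : ∀ {n} (f : Fin n → ℕ) → List.sum (tabulate f) ≡ sum f
sum-tabulate {zero} f = refl
sum-tabulate {suc n} f = cong (f zero +_) (sum-tabulate (f ∘ suc))

count≡∑ : ∀ n (f : Fin n → Bool) → count n f ≡ ∑[ i < n ] indicator (f i)
count≡∑ n f = trans (cong List.sum (map-tabulate id (indicator ∘ f))) (sum-tabulate (indicator ∘ f))

∑-const : ∀ n c → ∑[ i < n ] c ≡ n * c
∑-const zero c = refl
∑-const (suc n) c = cong (c +_) (∑-const n c)

∑-ones : ∀ n → ∑[ i < n ] 1 ≡ n
∑-ones n = trans (∑-const n 1) (*-identityʳ n)

∑-mono-≤ : ∀ {n} {f g : Fin n → ℕ} → (∀ i → f i ≤ g i) → sum f ≤ sum g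
∑-mono-≤ {zero} f≤g = z≤n
∑-mono-≤ {suc n} f≤g = +-mono-≤ (f≤g zero) (∑-mono-≤ (f≤g ∘ suc))

∑-*ˡ : ∀ {n} c (f : Fin n → ℕ) → ∑[ i < n ] (c * f i) ≡ c * sum f
∑-*ˡ c f = sym (*-distribˡ-sum c f)

∑-zero : ∀ {n} (f : Fin n → ℕ) → (∀ i → f i ≡ 0) → sum f ≡ 0
∑-zero {zero} f f≡0 = refl
∑-zero {suc n} f f≡0 = cong₂ _+_ (f≡0 zero) (∑-zero (f ∘ suc) (f≡0 ∘ suc))

∑-select : ∀ {n} (f : Fin n → ℕ) i → (∀ j → j ≢ i → f j ≡ 0) → sum f ≡ f i
∑-select f zero f≡0 = trans (cong (f zero +_) (∑-zero (f ∘ suc) (λ j → f≡0 (suc j) λ ()))) (+-identityʳ _)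
∑-select f (suc i) f≡0 =
  trans (cong (_+ sum (f ∘ suc)) (f≡0 zero λ ()))
        (∑-select (f ∘ suc) i λ j j≢i → f≡0 (suc j) (j≢i ∘ Fin.suc-injective))

∑-indicator≡0 : ∀ {n} (f : Fin n → Bool) → ∑[ i < n ] indicator (f i) ≡ 0 → ∀ i → f i ≡ false
∑-indicator≡0 {suc n} f sum≡0 i with f zero in f0≡
∑-indicator≡0 {suc n} f () i | true
∑-indicator≡0 {suc n} f sum≡0 zero | false = f0≡
∑-indicator≡0 {suc n} f sum≡0 (suc i) | false = ∑-indicator≡0 (f ∘ suc) sum≡0 i

∑-indicator≤1 : ∀ {n} (f : Fin n → Bool) → (∀ i j → f i ≡ true → f j ≡ true → i ≡ j) →
                ∑[ i < n ] indicator (f i) ≤ 1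
∑-indicator≤1 {zero} f unique = z≤n
∑-indicator≤1 {suc n} f unique with f zero in f0≡
... | true = ≤-reflexive (cong suc (∑-zero (indicator ∘ f ∘ suc) rest≡0))
  where
  rest≡0 : ∀ i → indicator (f (suc i)) ≡ 0
  rest≡0 i with f (suc i) in fi≡
  ... | true with () ← unique zero (suc i) f0≡ fi≡
  ... | false = refl
... | false = ∑-indicator≤1 (f ∘ suc) λ i j fi fj → Fin.suc-injective (unique (suc i) (suc j) fi fj)

∑-*-one-except : ∀ {n} (a g : Fin n → ℕ) j → (∀ i → i ≢ j → g i ≡ 1) →
                 ∑[ i < n ] (a i * g i) + a j ≡ sum a + g j * a j
∑-*-one-except {suc n} a g zero g≡1 = begin
  a zero * g zero + ∑[ i < n ] (a (suc i) * g (suc i)) + a zero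
    ≡⟨ cong (λ s → a zero * g zero + s + a zero) (sum-cong-≗ λ i → trans (cong (a (suc i) *_) (g≡1 (suc i) λ ())) (*-identityʳ _)) ⟩
  a zero * g zero + sum (a ∘ suc) + a zero
    ≡⟨ rearrange (a zero) (g zero) (sum (a ∘ suc)) ⟩
  a zero + sum (a ∘ suc) + g zero * a zero ∎
  where
  open ≡-Reasoning
  rearrange : ∀ x y s → x * y + s + x ≡ x + s + y * x
  rearrange = solve-∀
∑-*-one-except {suc n} a g (suc j) g≡1 = begin
  a zero * g zero + ∑[ i < n ] (a (suc i) * g (suc i)) + a (suc j)
    ≡⟨ +-assoc (a zero * g zero) _ _ ⟩
  a zero * g zero + (∑[ i < n ] (a (suc i) * g (suc i)) + a (suc j))
    ≡⟨ cong₂ _+_ (trans (cong (a zero *_) (g≡1 zero λ ())) (*-identityʳ (a zero)))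
                 (∑-*-one-except (a ∘ suc) (g ∘ suc) j λ i i≢j → g≡1 (suc i) (i≢j ∘ Fin.suc-injective)) ⟩
  a zero + (sum (a ∘ suc) + g (suc j) * a (suc j))
    ≡⟨ +-assoc (a zero) _ _ ⟨
  a zero + sum (a ∘ suc) + g (suc j) * a (suc j) ∎
  where open ≡-Reasoning

module Incidence {n L : ℕ} (χ : Fin n → Fin L → ℕ) where

  degree : (Fin L → ℕ) → Fin n → ℕ
  degree a p = ∑[ i < L ] (a i * χ p i)

  common : Fin L → Fin L → ℕ
  common i j = ∑[ p < n ] (χ p i * χ p j)

  ∑-*-degree : ∀ (w : Fin n → ℕ) a →
               ∑[ p < n ] (w p * degree a p) ≡ ∑[ i < L ] (a i * ∑[ p < n ] (w p * χ p i))
  ∑-*-degree w a = begin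
    ∑[ p < n ] (w p * degree a p)               ≡⟨ sum-cong-≗ (λ p → sym (∑-*ˡ (w p) (λ i → a i * χ p i))) ⟩
    ∑[ p < n ] ∑[ i < L ] (w p * (a i * χ p i)) ≡⟨ ∑-comm (λ p i → w p * (a i * χ p i)) ⟩
    ∑[ i < L ] ∑[ p < n ] (w p * (a i * χ p i)) ≡⟨ sum-cong-≗ (λ i → trans (sum-cong-≗ λ p → swap (w p) (a i) (χ p i)) (∑-*ˡ (a i) (λ p → w p * χ p i))) ⟩
    ∑[ i < L ] (a i * ∑[ p < n ] (w p * χ p i)) ∎
    where
    open ≡-Reasoning
    swap : ∀ x y z → x * (y * z) ≡ y * (x * z)
    swap = solve-∀

  ∑-degree : ∀ {r} → (∀ i → ∑[ p < n ] χ p i ≡ r) → ∀ a → ∑[ p < n ] degree a p ≡ sum a * r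
  ∑-degree {r} size a = begin
    ∑[ p < n ] degree a p                   ≡⟨ sum-cong-≗ (λ p → *-identityˡ (degree a p)) ⟨
    ∑[ p < n ] (1 * degree a p)             ≡⟨ ∑-*-degree (λ _ → 1) a ⟩
    ∑[ i < L ] (a i * ∑[ p < n ] (1 * χ p i)) ≡⟨ sum-cong-≗ (λ i → cong (a i *_) (trans (sum-cong-≗ λ p → *-identityˡ (χ p i)) (size i))) ⟩
    ∑[ i < L ] (a i * r)                    ≡⟨ *-distribʳ-sum r a ⟨
    sum a * r ∎
    where open ≡-Reasoning

  ∑-degree*degree : ∀ {r} → (∀ i → common i i ≡ r) → (∀ i j → i ≢ j → common i j ≡ 1) → ∀ a b →
                    ∑[ p < n ] (degree a p * degree b p) + ∑[ i < L ] (a i * b i)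
                    ≡ sum a * sum b + r * ∑[ i < L ] (a i * b i)
  ∑-degree*degree {r} self meet a b = begin
    ∑[ p < n ] (degree a p * degree b p) + ∑[ j < L ] (a j * b j)
      ≡⟨ cong₂ _+_ (∑-*-degree (degree a) b) (sum-cong-≗ λ j → *-comm (a j) (b j)) ⟩
    ∑[ j < L ] (b j * ∑[ p < n ] (degree a p * χ p j)) + ∑[ j < L ] (b j * a j)
      ≡⟨ ∑-distrib-+ (λ j → b j * ∑[ p < n ] (degree a p * χ p j)) (λ j → b j * a j) ⟨
    ∑[ j < L ] (b j * ∑[ p < n ] (degree a p * χ p j) + b j * a j)
      ≡⟨ sum-cong-≗ (λ j → trans (sym (*-distribˡ-+ (b j) _ _)) (cong (b j *_) (row j))) ⟩
    ∑[ j < L ] (b j * (sum a + r * a j))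
      ≡⟨ sum-cong-≗ (λ j → expand (b j) (sum a) r (a j)) ⟩
    ∑[ j < L ] (sum a * b j + r * (a j * b j))
      ≡⟨ ∑-distrib-+ (λ j → sum a * b j) (λ j → r * (a j * b j)) ⟩
    ∑[ j < L ] (sum a * b j) + ∑[ j < L ] (r * (a j * b j))
      ≡⟨ cong₂ _+_ (∑-*ˡ (sum a) b) (∑-*ˡ r (λ j → a j * b j)) ⟩
    sum a * sum b + r * ∑[ j < L ] (a j * b j) ∎
    where
    open ≡-Reasoning
    expand : ∀ x s r y → x * (s + r * y) ≡ s * x + r * (y * x)
    expand = solve-∀
    row : ∀ j → ∑[ p < n ] (degree a p * χ p j) + a j ≡ sum a + r * a j
    row j = begin
      ∑[ p < n ] (degree a p * χ p j) + a j
        ≡⟨ cong (_+ a j) (trans (sum-cong-≗ λ p → *-comm (degree a p) (χ p j)) (∑-*-degree (λ p → χ p j) a)) ⟩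
      ∑[ i < L ] (a i * common j i) + a j
        ≡⟨ ∑-*-one-except a (common j) j (λ i i≢j → meet j i (i≢j ∘ sym)) ⟩
      sum a + common j j * a j
        ≡⟨ cong (λ s → sum a + s * a j) (self j) ⟩
      sum a + r * a j ∎

data Coverage : ℕ → ℕ → Set where
  covered   : ∀ {d} → Coverage 1 (suc d)
  uncovered : Coverage 0 0

coverage-any : ∀ {A : Set} (f : A → Bool) xs →
               Coverage (indicator (any f xs)) (List.sum (map (indicator ∘ f) xs))
coverage-any f [] = uncovered
coverage-any f (x ∷ xs) with f x
... | true = covered
... | false = coverage-any f xs

covered-positive : ∀ {c d} → Coverage c d → 1 ≤ d → c ≡ 1
covered-positive covered _ = refl

≤-shift : ∀ {x y} a b s t → x ≤ y → a + s ≡ x + t → b + s ≡ y + t → a ≤ b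
≤-shift {x} {y} a b s t x≤y a+s≡x+t b+s≡y+t = +-cancelʳ-≤ s a b (begin
  a + s ≡⟨ a+s≡x+t ⟩
  x + t ≤⟨ +-monoˡ-≤ t x≤y ⟩
  y + t ≡⟨ b+s≡y+t ⟨
  b + s ∎)
  where open ≤-Reasoning

n≤n*n : ∀ n → n ≤ n * n
n≤n*n zero = z≤n
n≤n*n (suc n) = m≤m*n (suc n) (suc n)

-- The possible values at a point p of c = [p ∈ K], of the numbers t and o of lines of ℓ
-- through p that pass through, resp. miss, a covered point P of degree m, and of e = [p = P].
data Local (m : ℕ) : (c t o e : ℕ) → Set where
  centre         : Local m 1 m 0 1
  throughCentre  : ∀ o → Local m 1 1 o 0
  awayFromCentre : ∀ o → Local m 1 0 (suc o) 0
  outside        : Local m 0 0 0 0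

local-off-centre : ∀ {m c t o} → t ≤ 1 → Coverage c (t + o) → Local m c t o 0
local-off-centre z≤n covered = awayFromCentre _
local-off-centre z≤n uncovered = outside
local-off-centre (s≤s z≤n) covered = throughCentre _

local-upper : ∀ {m c t o e} → Local m c t o e → c + t * o + e * m ≤ (t + e) + o
local-upper {m} centre = ≤-reflexive (solve (m ∷ []))
local-upper {m} (throughCentre o) = ≤-reflexive (solve (m ∷ o ∷ []))
local-upper (awayFromCentre o) = s≤s z≤n
local-upper outside = z≤n

local-lower : ∀ {m c t o e} → Local m c t o e →
              2 * (t + e) + 3 * o ≤ 2 * (c + t * o + e * m) + o * o
local-lower {m} centre = ≤-reflexive (solve (m ∷ []))
local-lower {m} (throughCentre o) = ≤-shift _ _ 0 (2 + 2 * o) (n≤n*n o) (solve (m ∷ o ∷ [])) (solve (m ∷ o ∷ []))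
local-lower {m} (awayFromCentre o) = ≤-shift _ _ 0 (3 + 2 * o) (n≤n*n o) (solve (m ∷ o ∷ [])) (solve (m ∷ o ∷ []))
local-lower outside = z≤n

coverage-degree-bound : ∀ {m c d} → Coverage c d → d ≤ m → m * c + d * d ≤ m * d + d
coverage-degree-bound {m} uncovered _ = ≤-refl
coverage-degree-bound {m} {d = suc d} covered 1+d≤m =
  ≤-shift _ _ 0 (m + suc d) (*-mono-≤ (≤-refl {d}) 1+d≤m) (solve (m ∷ d ∷ [])) (solve (m ∷ d ∷ []))

n^2≡n*n : ∀ n → n ^ 2 ≡ n * n
n^2≡n*n n = cong (n *_) (*-identityʳ n)

m*n+m*o≤n*o+m*m : ∀ {m n o} → m ≤ n → m ≤ o → m * n + m * o ≤ n * o + m * m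
m*n+m*o≤n*o+m*m {m} m≤n m≤o with m≤n⇒∃[o]m+o≡n m≤n | m≤n⇒∃[o]m+o≡n m≤o
... | u , refl | v , refl = ≤-trans (m≤m+n _ (u * v)) (≤-reflexive (expand m u v))
  where
  expand : ∀ m u v → m * (m + u) + m * (m + v) + u * v ≡ (m + u) * (m + v) + m * m
  expand = solve-∀

upper-bound : ∀ q m k K → m + k ≡ suc q → 1 ≤ m →
              K + m * k + m ≤ m * q + 1 + k * q → K + k * q ≤ q ^ 2 + k ^ 2
upper-bound .(b + k) (suc b) k K refl _ summed rewrite n^2≡n*n (b + k) | n^2≡n*n k =
  ≤-shift _ _ (suc b * k + suc b) (k * (b + k)) summed (solve (b ∷ k ∷ K ∷ [])) (solve (b ∷ k ∷ K ∷ []))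

lower-bound : ∀ q m k K σ → m + k ≡ suc q → 1 ≤ m → σ + k ≡ k * k + q * k →
              2 * (m * q + 1) + 3 * (k * q) ≤ 2 * (K + m * k + m) + σ →
              2 * q ^ 2 + k * (k + 1) ≤ 2 * K + 2 * k * q
lower-bound .(b + k) (suc b) k K σ refl _ σ+k≡ summed rewrite n^2≡n*n (b + k) =
  ≤-shift _ _ (2 * (suc b * k) + 2 * suc b + (σ + k)) (k + 2 * k * (b + k)) summed
    (trans (cong (λ z → 2 * ((b + k) * (b + k)) + k * (k + 1) + (2 * (suc b * k) + 2 * suc b + z)) σ+k≡)
           (solve (b ∷ k ∷ [])))
    (solve (b ∷ k ∷ K ∷ σ ∷ []))

max-degree-bound : ∀ q m K σ → σ + suc q ≡ suc q * suc q + q * suc q →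
                   m * K + σ ≤ m * (suc q * q) + suc q * q →
                   m * K + q * (q + 1) ≤ m * (q * (q + 1))
max-degree-bound q m K σ σ+1+q≡ summed =
  ≤-shift _ _ (suc q * suc q) (suc q) summed
    (sym (trans (+-assoc (m * K) σ (suc q)) (trans (cong (m * K +_) σ+1+q≡) (solve (q ∷ m ∷ K ∷ [])))))
    (solve (q ∷ m ∷ []))

deficiency-upper : ∀ b k K {q} → b + k ≡ q → K + k * q ≤ q ^ 2 + k ^ 2 →
                   2 * (k * b) + 3 * q + 1 + 2 * K ≤ 2 * q ^ 2 + 3 * q + 1
deficiency-upper b k K refl upper rewrite n^2≡n*n (b + k) | n^2≡n*n k =
  ≤-shift _ _ (2 * (k * (b + k))) (2 * (k * b) + 3 * (b + k) + 1) (*-mono-≤ (≤-refl {2}) upper)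
    (solve (b ∷ k ∷ K ∷ [])) (solve (b ∷ k ∷ []))

deficiency-degree : ∀ q b K → suc b * K + q * (q + 1) ≤ suc b * (q * (q + 1)) →
                    (q + 1) * (suc b + 2 * q) + suc b * (2 * K) ≤ suc b * (2 * q ^ 2 + 3 * q + 1)
deficiency-degree q b K degree rewrite n^2≡n*n q =
  ≤-shift _ _ 0 (suc b * (q + 1)) (*-mono-≤ (≤-refl {2}) degree) (solve (q ∷ b ∷ K ∷ [])) (solve (q ∷ b ∷ []))

square-gap : ∀ q b → b * b + b ≤ q → (4 * q + 1) * (suc b * suc b) ≤ (suc b + 2 * q) * (suc b + 2 * q)
square-gap q b b²+b≤q =
  ≤-shift _ _ (4 * (q * (b * b + b))) ((4 * q + 1) * (suc b * suc b))
    (*-mono-≤ (≤-refl {4}) (*-mono-≤ (≤-refl {q}) b²+b≤q)) (solve (q ∷ b ∷ [])) (solve (q ∷ b ∷ []))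

deficiency²-from-upper : ∀ b k D {q} → b + k ≡ q → q ≤ k * k + k → q ≤ b * b + b →
                         2 * (k * b) + 3 * q + 1 ≤ D → (q + 1) ^ 2 * (4 * q + 1) ≤ D ^ 2
deficiency²-from-upper b k D refl q≤A q≤B X≤D
  rewrite n^2≡n*n (b + k + 1) | n^2≡n*n D = ≤-trans R≤X² (*-mono-≤ X≤D X≤D)
  where
  R≤X² : (b + k + 1) * (b + k + 1) * (4 * (b + k) + 1) ≤ (2 * (k * b) + 3 * (b + k) + 1) * (2 * (k * b) + 3 * (b + k) + 1)
  R≤X² = ≤-shift _ _ (4 * ((b + k) * (k * k + k) + (b + k) * (b * b + b))) ((b + k + 1) * (b + k + 1) * (4 * (b + k) + 1))
           (*-mono-≤ (≤-refl {4}) (m*n+m*o≤n*o+m*m q≤A q≤B)) (solve (b ∷ k ∷ [])) (solve (b ∷ k ∷ []))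

deficiency²-from-degree : ∀ q b D → b * b + b ≤ q → (q + 1) * (suc b + 2 * q) ≤ suc b * D →
                          (q + 1) ^ 2 * (4 * q + 1) ≤ D ^ 2
deficiency²-from-degree q b D b²+b≤q gap rewrite n^2≡n*n (q + 1) | n^2≡n*n D =
  *-cancelʳ-≤ _ _ (suc b * suc b) (begin
    (q + 1) * (q + 1) * (4 * q + 1) * (suc b * suc b)           ≡⟨ solve (q ∷ b ∷ []) ⟩
    (q + 1) * (q + 1) * ((4 * q + 1) * (suc b * suc b))         ≤⟨ *-mono-≤ (≤-refl {(q + 1) * (q + 1)}) (square-gap q b b²+b≤q) ⟩
    (q + 1) * (q + 1) * ((suc b + 2 * q) * (suc b + 2 * q))     ≡⟨ solve (q ∷ b ∷ []) ⟩
    ((q + 1) * (suc b + 2 * q)) * ((q + 1) * (suc b + 2 * q))   ≤⟨ *-mono-≤ gap gap ⟩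
    (suc b * D) * (suc b * D)                                   ≡⟨ solve (b ∷ D ∷ []) ⟩
    D * D * (suc b * suc b)                                     ∎)
  where open ≤-Reasoning

q≤k²+k : ∀ q k → ¬ ((2 * k + 1) ^ 2 < 4 * q + 1) → q ≤ k * k + k
q≤k²+k q k k-large =
  *-cancelˡ-≤ 4 (+-cancelʳ-≤ 1 _ _ (subst (4 * q + 1 ≤_) (trans (n^2≡n*n (2 * k + 1)) (solve (k ∷ []))) (≮⇒≥ k-large)))

small-k : ∀ q m k K → m + k ≡ suc q → 1 ≤ m →
          K + k * q ≤ q ^ 2 + k ^ 2 → m * K + q * (q + 1) ≤ m * (q * (q + 1)) →
          (2 * q ^ 2 + 3 * q + 1 ∸ 2 * K) ^ 2 < (q + 1) ^ 2 * (4 * q + 1) →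
          (2 * k + 1) ^ 2 < 4 * q + 1
small-k q (suc b) k K 1+b+k≡1+q _ upper degree small-deficiency with (2 * k + 1) ^ 2 <? 4 * q + 1
... | yes k-small = k-small
... | no k-large = contradiction small-deficiency (≤⇒≯ R≤D²)
  where
  b+k≡q : b + k ≡ q
  b+k≡q = suc-injective 1+b+k≡1+q
  R≤D² : (q + 1) ^ 2 * (4 * q + 1) ≤ (2 * q ^ 2 + 3 * q + 1 ∸ 2 * K) ^ 2
  R≤D² with q ≤? b * b + b
  ... | yes q≤b²+b = deficiency²-from-upper b k _ b+k≡q (q≤k²+k q k k-large) q≤b²+b
                       (m+n≤o⇒m≤o∸n _ (deficiency-upper b k K b+k≡q upper))
  ... | no q≰b²+b = deficiency²-from-degree q b _ (≰⇒≥ q≰b²+b)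
                      (≤-trans (m+n≤o⇒m≤o∸n _ (deficiency-degree q b K degree))
                               (≤-reflexive (sym (*-distribˡ-∸ (suc b) _ (2 * K)))))

module KakeyaCounting {q : ℕ} (A : AffinePlane q) (ℓ : Fin (suc q) → Fin (q * q + q))
                      (nonParallel : PairwiseNonParallel A ℓ) where
  open AffinePlane A

  χ : Fin (q * q) → Fin (suc q) → ℕ
  χ p i = indicator (inc p (ℓ i))

  open Incidence χ public

  member : Fin (q * q) → ℕ
  member p = indicator (inKakeya A ℓ p)

  deg : Fin (q * q) → ℕ
  deg = degree (λ _ → 1)

  knotDegree≡deg : ∀ p → knotDegree A ℓ p ≡ deg p
  knotDegree≡deg p = trans (count≡∑ (suc q) (λ i → inc p (ℓ i))) (sum-cong-≗ λ i → sym (*-identityˡ (χ p i)))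

  kakeyaSize≡∑member : kakeyaSize A ℓ ≡ ∑[ p < q * q ] member p
  kakeyaSize≡∑member = count≡∑ (q * q) (inKakeya A ℓ)

  coverage : ∀ p → Coverage (member p) (deg p)
  coverage p = subst (Coverage (member p)) (knotDegree≡deg p) (coverage-any (λ i → inc p (ℓ i)) (allFin (suc q)))

  line-size : ∀ i → ∑[ p < q * q ] χ p i ≡ q
  line-size i = trans (sym (count≡∑ (q * q) (λ p → inc p (ℓ i)))) (lineSize (ℓ i))

  common-self : ∀ i → common i i ≡ q
  common-self i = trans (sum-cong-≗ λ p → trans (indicator-∧ (inc p (ℓ i)) _) (cong indicator (∧-idem (inc p (ℓ i))))) (line-size i)

  common-distinct : ∀ i j → i ≢ j → common i j ≡ 1
  common-distinct i j i≢j = trans (sum-cong-≗ λ p → indicator-∧ (inc p (ℓ i)) (inc p (ℓ j))) (≤-antisym at-most-one at-least-one)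
    where
    on-both : Fin (q * q) → Bool
    on-both p = inc p (ℓ i) ∧ inc p (ℓ j)
    ℓi≢ℓj : ℓ i ≢ ℓ j
    ℓi≢ℓj = nonParallel i j i≢j ∘ inj₁
    at-most-one : ∑[ p < q * q ] indicator (on-both p) ≤ 1
    at-most-one = ∑-indicator≤1 on-both λ p p' on-p on-p' →
      meetAtMostOne (ℓ i) (ℓ j) ℓi≢ℓj p p'
        (∧-conicalˡ _ _ on-p) (∧-conicalʳ _ _ on-p) (∧-conicalˡ _ _ on-p') (∧-conicalʳ _ _ on-p')
    at-least-one : 1 ≤ ∑[ p < q * q ] indicator (on-both p)
    at-least-one = n≢0⇒n>0 λ none → nonParallel i j i≢j (inj₂ λ p (on-i , on-j) →
      case trans (sym (cong₂ _∧_ on-i on-j)) (∑-indicator≡0 on-both none p) of λ ())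

  K : ℕ
  K = kakeyaSize A ℓ

  ∑-deg : ∑[ p < q * q ] deg p ≡ suc q * q
  ∑-deg = trans (∑-degree line-size (λ _ → 1)) (cong (_* q) (∑-ones (suc q)))

  ∑-deg² : ∑[ p < q * q ] (deg p * deg p) + suc q ≡ suc q * suc q + q * suc q
  ∑-deg² = begin
    ∑[ p < q * q ] (deg p * deg p) + suc q          ≡⟨ cong (∑[ p < q * q ] (deg p * deg p) +_) (∑-ones (suc q)) ⟨
    ∑[ p < q * q ] (deg p * deg p) + ∑[ i < suc q ] 1 ≡⟨ ∑-degree*degree common-self common-distinct (λ _ → 1) (λ _ → 1) ⟩
    ∑[ i < suc q ] 1 * ∑[ i < suc q ] 1 + q * ∑[ i < suc q ] 1 ≡⟨ cong (λ n → n * n + q * n) (∑-ones (suc q)) ⟩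
    suc q * suc q + q * suc q ∎
    where open ≡-Reasoning

  max-degree-sum : ∀ P → (∀ p → deg p ≤ deg P) →
                   deg P * K + ∑[ p < q * q ] (deg p * deg p) ≤ deg P * (suc q * q) + suc q * q
  max-degree-sum P maximal = begin
    deg P * K + ∑[ p < q * q ] (deg p * deg p)
      ≡⟨ cong (λ n → deg P * n + ∑[ p < q * q ] (deg p * deg p)) kakeyaSize≡∑member ⟩
    deg P * sum member + ∑[ p < q * q ] (deg p * deg p)
      ≡⟨ cong (_+ ∑[ p < q * q ] (deg p * deg p)) (∑-*ˡ (deg P) member) ⟨
    ∑[ p < q * q ] (deg P * member p) + ∑[ p < q * q ] (deg p * deg p)
      ≡⟨ ∑-distrib-+ (λ p → deg P * member p) (λ p → deg p * deg p) ⟨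
    ∑[ p < q * q ] (deg P * member p + deg p * deg p)
      ≤⟨ ∑-mono-≤ (λ p → coverage-degree-bound (coverage p) (maximal p)) ⟩
    ∑[ p < q * q ] (deg P * deg p + deg p)
      ≡⟨ ∑-distrib-+ (λ p → deg P * deg p) deg ⟩
    ∑[ p < q * q ] (deg P * deg p) + sum deg
      ≡⟨ cong₂ _+_ (trans (∑-*ˡ (deg P) deg) (cong (deg P *_) ∑-deg)) ∑-deg ⟩
    deg P * (suc q * q) + suc q * q ∎
    where open ≤-Reasoning

  degree-bound : ∀ P → (∀ p → deg p ≤ deg P) → deg P * K + q * (q + 1) ≤ deg P * (q * (q + 1))
  degree-bound P maximal = max-degree-bound q (deg P) K _ ∑-deg² (max-degree-sum P maximal)

  module Centre (P : Fin (q * q)) (P∈K : 1 ≤ deg P) where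

    m : ℕ
    m = deg P

    through : Fin (suc q) → ℕ
    through i = χ P i

    missing : Fin (suc q) → ℕ
    missing i = indicator (not (inc P (ℓ i)))

    k : ℕ
    k = sum missing

    t o e : Fin (q * q) → ℕ
    t = degree through
    o = degree missing
    e p = indicator (does (p ≟ P))

    through+missing : ∀ i → through i + missing i ≡ 1
    through+missing i with inc P (ℓ i)
    ... | true = refl
    ... | false = refl

    through*missing : ∀ i → through i * missing i ≡ 0
    through*missing i with inc P (ℓ i)
    ... | true = refl
    ... | false = refl

    missing*missing : ∀ i → missing i * missing i ≡ missing i
    missing*missing i with inc P (ℓ i)
    ... | true = refl
    ... | false = refl

    m≡∑through : m ≡ sum through
    m≡∑through = sum-cong-≗ λ i → *-identityˡ (χ P i)

    m+k≡1+q : m + k ≡ suc q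
    m+k≡1+q = begin
      m + k                                 ≡⟨ cong (_+ k) m≡∑through ⟩
      sum through + sum missing             ≡⟨ ∑-distrib-+ through missing ⟨
      ∑[ i < suc q ] (through i + missing i) ≡⟨ sum-cong-≗ through+missing ⟩
      ∑[ i < suc q ] 1                      ≡⟨ ∑-ones (suc q) ⟩
      suc q ∎
      where open ≡-Reasoning

    deg≡t+o : ∀ p → deg p ≡ t p + o p
    deg≡t+o p = trans (sum-cong-≗ split) (∑-distrib-+ (λ i → through i * χ p i) (λ i → missing i * χ p i))
      where
      split : ∀ i → 1 * χ p i ≡ through i * χ p i + missing i * χ p i
      split i = trans (cong (_* χ p i) (sym (through+missing i))) (*-distribʳ-+ (χ p i) (through i) (missing i))

    t-centre : t P ≡ m
    t-centre = sum-cong-≗ λ i → trans (indicator-∧ (inc P (ℓ i)) _) (trans (cong indicator (∧-idem _)) (sym (*-identityˡ (χ P i))))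

    o-centre : o P ≡ 0
    o-centre = ∑-zero (λ i → missing i * χ P i) λ i → trans (*-comm (missing i) (χ P i)) (through*missing i)

    t≤1 : ∀ {p} → p ≢ P → t p ≤ 1
    t≤1 {p} p≢P = ≤-trans (≤-reflexive (sum-cong-≗ λ i → indicator-∧ (inc P (ℓ i)) (inc p (ℓ i))))
                          (∑-indicator≤1 (λ i → inc P (ℓ i) ∧ inc p (ℓ i)) unique)
      where
      unique : ∀ i j → inc P (ℓ i) ∧ inc p (ℓ i) ≡ true → inc P (ℓ j) ∧ inc p (ℓ j) ≡ true → i ≡ j
      unique i j on-i on-j with i ≟ j
      ... | yes i≡j = i≡j
      ... | no i≢j = contradiction
        (meetAtMostOne (ℓ i) (ℓ j) (nonParallel i j i≢j ∘ inj₁) P p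
          (∧-conicalˡ _ _ on-i) (∧-conicalˡ _ _ on-j) (∧-conicalʳ _ _ on-i) (∧-conicalʳ _ _ on-j))
        (p≢P ∘ sym)

    e-centre : e P ≡ 1
    e-centre = cong indicator (dec-true (P ≟ P) refl)

    e-other : ∀ {p} → p ≢ P → e p ≡ 0
    e-other {p} p≢P = cong indicator (dec-false (p ≟ P) p≢P)

    local-at : ∀ p → Local m (member p) (t p) (o p) (e p)
    local-at p with p ≟ P
    ... | yes refl rewrite covered-positive (coverage P) P∈K | t-centre | o-centre = centre
    ... | no p≢P = local-off-centre (t≤1 p≢P) (subst (Coverage (member p)) (deg≡t+o p) (coverage p))

    ∑t : sum t ≡ m * q
    ∑t = trans (∑-degree line-size through) (cong (_* q) (sym m≡∑through))

    ∑o : sum o ≡ k * q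
    ∑o = ∑-degree line-size missing

    ∑through*missing : ∑[ i < suc q ] (through i * missing i) ≡ 0
    ∑through*missing = ∑-zero (λ i → through i * missing i) through*missing

    ∑t*o : ∑[ p < q * q ] (t p * o p) ≡ m * k
    ∑t*o = +-cancelʳ-≡ 0 _ _ (begin
      ∑[ p < q * q ] (t p * o p) + 0
        ≡⟨ cong (∑[ p < q * q ] (t p * o p) +_) ∑through*missing ⟨
      ∑[ p < q * q ] (t p * o p) + ∑[ i < suc q ] (through i * missing i)
        ≡⟨ ∑-degree*degree common-self common-distinct through missing ⟩
      sum through * k + q * ∑[ i < suc q ] (through i * missing i)
        ≡⟨ cong₂ (λ a b → a * k + q * b) (sym m≡∑through) ∑through*missing ⟩
      m * k + q * 0
        ≡⟨ cong (m * k +_) (*-zeroʳ q) ⟩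
      m * k + 0 ∎)
      where open ≡-Reasoning

    ∑o*o : ∑[ p < q * q ] (o p * o p) + k ≡ k * k + q * k
    ∑o*o = begin
      ∑[ p < q * q ] (o p * o p) + k
        ≡⟨ cong (∑[ p < q * q ] (o p * o p) +_) ∑missing² ⟨
      ∑[ p < q * q ] (o p * o p) + ∑[ i < suc q ] (missing i * missing i)
        ≡⟨ ∑-degree*degree common-self common-distinct missing missing ⟩
      k * k + q * ∑[ i < suc q ] (missing i * missing i)
        ≡⟨ cong (λ s → k * k + q * s) ∑missing² ⟩
      k * k + q * k ∎
      where
      open ≡-Reasoning
      ∑missing² : ∑[ i < suc q ] (missing i * missing i) ≡ k
      ∑missing² = sum-cong-≗ missing*missing

    ∑e : sum e ≡ 1
    ∑e = trans (∑-select e P λ p → e-other) e-centre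

    ∑e*m : ∑[ p < q * q ] (e p * m) ≡ m
    ∑e*m = trans (∑-select (λ p → e p * m) P λ p p≢P → cong (_* m) (e-other p≢P))
                 (trans (cong (_* m) e-centre) (*-identityˡ m))

    ∑member+t*o+e*m : ∑[ p < q * q ] (member p + t p * o p + e p * m) ≡ K + m * k + m
    ∑member+t*o+e*m = trans (∑-distrib-+ (λ p → member p + t p * o p) (λ p → e p * m))
      (cong₂ _+_ (trans (∑-distrib-+ member (λ p → t p * o p)) (cong₂ _+_ (sym kakeyaSize≡∑member) ∑t*o)) ∑e*m)

    ∑t+e : ∑[ p < q * q ] (t p + e p) ≡ m * q + 1
    ∑t+e = trans (∑-distrib-+ t e) (cong₂ _+_ ∑t ∑e)

    upper-sum : K + m * k + m ≤ m * q + 1 + k * q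
    upper-sum = begin
      K + m * k + m                                       ≡⟨ ∑member+t*o+e*m ⟨
      ∑[ p < q * q ] (member p + t p * o p + e p * m)     ≤⟨ ∑-mono-≤ (local-upper ∘ local-at) ⟩
      ∑[ p < q * q ] ((t p + e p) + o p)                  ≡⟨ ∑-distrib-+ (λ p → t p + e p) o ⟩
      ∑[ p < q * q ] (t p + e p) + sum o                  ≡⟨ cong₂ _+_ ∑t+e ∑o ⟩
      m * q + 1 + k * q ∎
      where open ≤-Reasoning

    lower-sum : 2 * (m * q + 1) + 3 * (k * q) ≤ 2 * (K + m * k + m) + ∑[ p < q * q ] (o p * o p)
    lower-sum = begin
      2 * (m * q + 1) + 3 * (k * q)
        ≡⟨ cong₂ _+_ (trans (∑-*ˡ 2 (λ p → t p + e p)) (cong (2 *_) ∑t+e)) (trans (∑-*ˡ 3 o) (cong (3 *_) ∑o)) ⟨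
      ∑[ p < q * q ] (2 * (t p + e p)) + ∑[ p < q * q ] (3 * o p)
        ≡⟨ ∑-distrib-+ (λ p → 2 * (t p + e p)) (λ p → 3 * o p) ⟨
      ∑[ p < q * q ] (2 * (t p + e p) + 3 * o p)
        ≤⟨ ∑-mono-≤ (local-lower ∘ local-at) ⟩
      ∑[ p < q * q ] (2 * (member p + t p * o p + e p * m) + o p * o p)
        ≡⟨ ∑-distrib-+ (λ p → 2 * (member p + t p * o p + e p * m)) (λ p → o p * o p) ⟩
      ∑[ p < q * q ] (2 * (member p + t p * o p + e p * m)) + ∑[ p < q * q ] (o p * o p)
        ≡⟨ cong (_+ ∑[ p < q * q ] (o p * o p)) (trans (∑-*ˡ 2 (λ p → member p + t p * o p + e p * m)) (cong (2 *_) ∑member+t*o+e*m)) ⟩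
      2 * (K + m * k + m) + ∑[ p < q * q ] (o p * o p) ∎
      where open ≤-Reasoning

    kakeyaSize-upper : K + k * q ≤ q ^ 2 + k ^ 2
    kakeyaSize-upper = upper-bound q m k K m+k≡1+q P∈K upper-sum

    kakeyaSize-lower : 2 * q ^ 2 + k * (k + 1) ≤ 2 * K + 2 * k * q
    kakeyaSize-lower = lower-bound q m k K _ m+k≡1+q P∈K ∑o*o lower-sum

    knot : knotDegree A ℓ P + k ≡ q + 1
    knot = trans (cong (_+ k) (knotDegree≡deg P)) (trans m+k≡1+q (+-comm 1 q))

  maximal-point : 1 ≤ q → Σ (Fin (q * q)) λ P → ∀ p → deg p ≤ deg P
  maximal-point 1≤q = argmax deg p₀ (allFin (q * q)) , λ p → lookup (f[xs]≤f[argmax] p₀ (allFin (q * q))) (∈-allFin p)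
    where
    p₀ : Fin (q * q)
    p₀ = fromℕ< (*-mono-≤ 1≤q 1≤q)

  maximal-covered : ∀ {P} → 1 ≤ q → (∀ p → deg p ≤ deg P) → 1 ≤ deg P
  maximal-covered {P} 1≤q maximal = n≢0⇒n>0 λ deg≡0 → <⇒≱ (*-mono-≤ (s≤s (z≤n {q})) 1≤q) (begin
    suc q * q                    ≡⟨ ∑-deg ⟨
    sum deg                      ≤⟨ ∑-mono-≤ maximal ⟩
    ∑[ p < q * q ] deg P         ≡⟨ ∑-const (q * q) (deg P) ⟩
    q * q * deg P                ≡⟨ cong (q * q *_) deg≡0 ⟩
    q * q * 0                    ≡⟨ *-zeroʳ (q * q) ⟩
    0 ∎)
    where open ≤-Reasoning

corollary2p4 : (q : ℕ) → 4 ≤ q → (A : AffinePlane q) →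
    (ℓ : Fin (suc q) → Fin (q * q + q)) → PairwiseNonParallel A ℓ →
    -- |K| > q² − ((q+1)√(q+1/4) − (3q+1)/2), i.e. (2q²+3q+1 − 2|K|) < (q+1)√(4q+1)
    (2 * q ^ 2 + 3 * q + 1 ∸ 2 * kakeyaSize A ℓ) ^ 2 < (q + 1) ^ 2 * (4 * q + 1) →
    Σ ℕ λ k →
      -- 0 ≤ k < √(q+1/4) − 1/2, i.e. 2k+1 < √(4q+1)
      (2 * k + 1) ^ 2 < 4 * q + 1 ×
      -- K contains a (q+1−k)-knot
      Σ (Fin (q * q)) (λ p → knotDegree A ℓ p + k ≡ q + 1) ×
      -- q² − kq + k(k+1)/2 ≤ |K|
      2 * q ^ 2 + k * (k + 1) ≤ 2 * kakeyaSize A ℓ + 2 * k * q ×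
      -- |K| ≤ q² − kq + k²
      kakeyaSize A ℓ + k * q ≤ q ^ 2 + k ^ 2
corollary2p4 q 4≤q A ℓ nonParallel small-deficiency =
  k , small-k q m k K m+k≡1+q P∈K kakeyaSize-upper (degree-bound P maximal) small-deficiency ,
  (P , knot) , kakeyaSize-lower , kakeyaSize-upper
  where
  open KakeyaCounting A ℓ nonParallel
  1≤q : 1 ≤ q
  1≤q = ≤-trans (s≤s z≤n) 4≤q
  P : Fin (q * q)
  P = proj₁ (maximal-point 1≤q)
  maximal : ∀ p → deg p ≤ deg P
  maximal = proj₂ (maximal-point 1≤q)
  P∈K : 1 ≤ deg P
  P∈K = maximal-covered 1≤q maximal
  open Centre P P∈K
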